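{- Let $\mathbf A$ be a 0-commutative orthogroupoid and let $e$ be an atom of the Boolean algebra $\mathrm{Ce}(\mathbf A)$ of central elements of $\mathbf A$. Then $At(\mathbf A_{e'})=At(\mathbf A)\setminus\{e\}$, where $At(\mathbf B)$ denotes the set of atoms of the Boolean algebra $\mathrm{Ce}(\mathbf B)$.
   Context: An orthogroupoid is an algebra $\langle A,+,',1\rangle$ of type $(2,1,0)$, with $0:=1'$, satisfying: (a) $x''\approx x$; (b) $0+x\approx x$ and $x+1\approx 1$; (c) $x+x'\approx 1$; (d) for all $x,z$: if $x+z=z$ and $x'+z=z$ then $z=1$; (e) $(((z+y)'+(z+x))'+(z+y)')+z'\approx z'$; (f) $x+(x+y)\approx x+y$ and $y+(x+y)\approx x+y$. It is 0-commutative if it satisfies $x+0\approx 0+x$. Define $x\cdot y:=(x'+y')'$, $q(x,y,z)=(x+z)\cdot(x'+y)$ and $x\wedge y:=q(x,y,0)$. An element $e$ is central if the principal congruences $\theta(e,0)$ and $\theta(e,1)$ form a pair of factor congruences. The central elements form a Boolean algebra $\mathrm{Ce}(\mathbf A)=\langle\mathrm{Ce}(A),+,\cdot,',0,1\rangle$. For a central $e$, $\mathbf A_e$ is the algebra with universe $A_e=\{e\wedge b:b\in A\}$ and operations $g_e(e\wedge b_1,\dots,e\wedge b_n)=e\wedge g(e\wedge b_1,\dots,e\wedge b_n)$; it is again a 0-commutative orthogroupoid (with top constant $e$), and its central elements are defined relative to its own operations. -}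

module Defs where

open import Data.Product using (Σ; ∃; _×_; _,_; proj₁)
open import Data.Sum using (_⊎_)
open import Relation.Nullary using (¬_)
open import Relation.Binary.PropositionalEquality using (_≡_; refl)

record Orthogroupoid : Set₁ where
  field
    Carrier : Set
    _+_     : Carrier → Carrier → Carrier
    _′      : Carrier → Carrier
    𝟏       : Carrier

  infixl 6 _+_
  infix 8 _′

  𝟎 : Carrier
  𝟎 = 𝟏 ′

  field
    ax-a  : ∀ x → x ′ ′ ≡ x
    ax-b1 : ∀ x → 𝟎 + x ≡ x
    ax-b2 : ∀ x → x + 𝟏 ≡ 𝟏
    ax-c  : ∀ x → x + x ′ ≡ 𝟏
    ax-d  : ∀ x z → x + z ≡ z → x ′ + z ≡ z → z ≡ 𝟏
    ax-e  : ∀ x y z → (((z + y) ′ + (z + x)) ′ + (z + y) ′) + z ′ ≡ z ′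
    ax-f1 : ∀ x y → x + (x + y) ≡ x + y
    ax-f2 : ∀ x y → y + (x + y) ≡ x + y

  _·_ : Carrier → Carrier → Carrier
  x · y = (x ′ + y ′) ′

  q : Carrier → Carrier → Carrier → Carrier
  q x y z = (x + z) · (x ′ + y)

  _∧_ : Carrier → Carrier → Carrier
  x ∧ y = q x y 𝟎

ZeroCommutative : Orthogroupoid → Set
ZeroCommutative A = ∀ x → x + 𝟎 ≡ 𝟎 + x
  where open Orthogroupoid A

-- General algebras of type (2,1,0) presented on a setoid-like carrier
-- (carrier together with its equality relation); used to treat both A
-- (with ≡) and the relativized algebras A_e (subsets of A, with equality
-- of underlying elements of A) uniformly.
record Alg : Set₁ where
  field
    U    : Set
    _≈_  : U → U → Set
    _⊕_  : U → U → U
    neg  : U → U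
    top  : U

  bot : U
  bot = neg top

module _ (B : Alg) where
  open Alg B

  data Θ (a b : U) : U → U → Set where
    θ-base  : Θ a b a b
    θ-eq    : ∀ {x y} → x ≈ y → Θ a b x y
    θ-refl  : ∀ {x} → Θ a b x x
    θ-sym   : ∀ {x y} → Θ a b x y → Θ a b y x
    θ-trans : ∀ {x y z} → Θ a b x y → Θ a b y z → Θ a b x z
    θ-⊕     : ∀ {x x′ y y′} → Θ a b x x′ → Θ a b y y′ → Θ a b (x ⊕ y) (x′ ⊕ y′)
    θ-neg   : ∀ {x y} → Θ a b x y → Θ a b (neg x) (neg y)

  -- θ(e,0), θ(e,1) form a pair of factor congruences:
  -- θ(e,0) ∩ θ(e,1) = Δ  and  θ(e,0) ∘ θ(e,1) = ∇.
  IsCentral : U → Set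
  IsCentral e =
    (∀ x y → Θ e bot x y → Θ e top x y → x ≈ y) ×
    (∀ x y → ∃ λ z → Θ e bot x z × Θ e top z y)

  -- Atoms of the Boolean algebra Ce(B) = ⟨Ce(B), ⊕, ·, neg, bot, top⟩,
  -- with lattice order f ≤ e iff f ⊕ e = e.
  IsAtom : U → Set
  IsAtom e =
    IsCentral e × ¬ (e ≈ bot) ×
    (∀ f → IsCentral f → (f ⊕ e) ≈ e → (f ≈ bot) ⊎ (f ≈ e))

asAlg : Orthogroupoid → Alg
asAlg A = record
  { U = Carrier ; _≈_ = _≡_ ; _⊕_ = _+_ ; neg = _′ ; top = 𝟏 }
  where open Orthogroupoid A

-- A_e : universe { e ∧ b : b ∈ A }, operations g_e(…) = e ∧ g(…)
-- (for the nullary operation 1 this is e ∧ 1).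
InA_ : (A : Orthogroupoid) → Orthogroupoid.Carrier A → Orthogroupoid.Carrier A → Set
InA_ A e x = Σ (Orthogroupoid.Carrier A) λ b → x ≡ Orthogroupoid._∧_ A e b

relAlg : (A : Orthogroupoid) → Orthogroupoid.Carrier A → Alg
relAlg A e = record
  { U   = Σ Carrier (InA_ A e)
  ; _≈_ = λ x y → proj₁ x ≡ proj₁ y
  ; _⊕_ = λ x y → (e ∧ (proj₁ x + proj₁ y)) , (proj₁ x + proj₁ y) , refl
  ; neg = λ x → (e ∧ (proj₁ x ′)) , (proj₁ x ′) , refl
  ; top = (e ∧ 𝟏) , 𝟏 , refl
  }
  where open Orthogroupoid A

-- A unary polynomial function of A is compatible with every congruence, so for a central c
-- the factor pair θ(c,0), θ(c,1) determines its value at c from its values at 0 and 1.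
-- So every identity between polynomials that holds at 0 and 1 holds at c, and centrality
-- becomes equivalent to a finite list of such identities.  Transporting congruences along
-- d ∧ _ then shows that for central d the central elements of A_d are exactly the central
-- elements of A lying in A_d, and that central elements below an element of A_d lie in A_d;
-- hence the atoms of A_d are the atoms of A inside A_d.  For d = e′ with e an atom, an atom
-- x ≠ e satisfies e ∧ x = 0, which places it in A_{e′}, while e itself is not in A_{e′}.
module Submission where

open import Defs
open import Data.Empty using (⊥-elim)
open import Data.Product using (Σ; ∃; _×_; _,_; proj₁)
open import Data.Sum using (_⊎_; inj₁; inj₂)
import Data.Sum as Sum
open import Function using (id)
open import Relation.Nullary using (¬_)
open import Relation.Binary.PropositionalEquality
open ≡-Reasoning

module Properties (A : Orthogroupoid) (zc : ZeroCommutative A) where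
  open Orthogroupoid A

  𝔸 : Alg
  𝔸 = asAlg A

  ′-𝟎 : 𝟎 ′ ≡ 𝟏
  ′-𝟎 = ax-a 𝟏

  +-zeroˡ : ∀ y → 𝟏 + y ≡ 𝟏
  +-zeroˡ y = ax-d 𝟏 (𝟏 + y) (ax-f1 𝟏 y) (ax-b1 (𝟏 + y))

  +-identityʳ : ∀ y → y + 𝟎 ≡ y
  +-identityʳ y = trans (zc y) (ax-b1 y)

  q-𝟏 : ∀ y z → q 𝟏 y z ≡ y
  q-𝟏 y z = begin
    ((𝟏 + z) ′ + (𝟎 + y) ′) ′  ≡⟨ cong (λ w → (w ′ + (𝟎 + y) ′) ′) (+-zeroˡ z) ⟩
    (𝟎 + (𝟎 + y) ′) ′          ≡⟨ cong _′ (ax-b1 _) ⟩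
    (𝟎 + y) ′ ′                ≡⟨ ax-a _ ⟩
    𝟎 + y                      ≡⟨ ax-b1 y ⟩
    y                          ∎

  q-𝟎 : ∀ y z → q 𝟎 y z ≡ z
  q-𝟎 y z = begin
    ((𝟎 + z) ′ + (𝟎 ′ + y) ′) ′  ≡⟨ cong (λ w → ((𝟎 + z) ′ + (w + y) ′) ′) ′-𝟎 ⟩
    ((𝟎 + z) ′ + (𝟏 + y) ′) ′    ≡⟨ cong (λ w → ((𝟎 + z) ′ + w ′) ′) (+-zeroˡ y) ⟩
    ((𝟎 + z) ′ + 𝟎) ′            ≡⟨ cong _′ (+-identityʳ _) ⟩
    (𝟎 + z) ′ ′                  ≡⟨ ax-a _ ⟩
    𝟎 + z                        ≡⟨ ax-b1 z ⟩
    z                            ∎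

  ∧-zeroˡ : ∀ t → 𝟎 ∧ t ≡ 𝟎
  ∧-zeroˡ t = q-𝟎 t 𝟎

  ∧-identityˡ : ∀ t → 𝟏 ∧ t ≡ t
  ∧-identityˡ t = q-𝟏 t 𝟎

  _≼_ : Carrier → Carrier → Set
  x ≼ y = x + y ≡ y

  infixl 6 _⊕_
  infixl 7 _∧ᴾ_
  infix 8 _ᶜ

  data Poly : Set where
    var : Poly
    ⌜_⌝ : Carrier → Poly
    _⊕_ : Poly → Poly → Poly
    _ᶜ  : Poly → Poly

  ⟦_⟧ : Poly → Carrier → Carrier
  ⟦ var ⟧   c = c
  ⟦ ⌜ a ⌝ ⟧ c = a
  ⟦ s ⊕ t ⟧ c = ⟦ s ⟧ c + ⟦ t ⟧ c
  ⟦ t ᶜ ⟧   c = ⟦ t ⟧ c ′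

  qᴾ : Poly → Poly → Poly → Poly
  qᴾ s t u = ((s ⊕ u) ᶜ ⊕ (s ᶜ ⊕ t) ᶜ) ᶜ

  _∧ᴾ_ : Poly → Poly → Poly
  s ∧ᴾ t = qᴾ s t ⌜ 𝟎 ⌝

  Θ-compatible : ∀ t {a b x y} → Θ 𝔸 a b x y → Θ 𝔸 a b (⟦ t ⟧ x) (⟦ t ⟧ y)
  Θ-compatible var     x≈y = x≈y
  Θ-compatible ⌜ _ ⌝   x≈y = θ-refl
  Θ-compatible (s ⊕ t) x≈y = θ-⊕ (Θ-compatible s x≈y) (Θ-compatible t x≈y)
  Θ-compatible (t ᶜ)   x≈y = θ-neg (Θ-compatible t x≈y)

  central-agree : ∀ {c} → IsCentral 𝔸 c → ∀ s t →
    ⟦ s ⟧ 𝟎 ≡ ⟦ t ⟧ 𝟎 → ⟦ s ⟧ 𝟏 ≡ ⟦ t ⟧ 𝟏 → ⟦ s ⟧ c ≡ ⟦ t ⟧ c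
  central-agree {c} (Θ₀∩Θ₁≡Δ , _) s t s≡t₀ s≡t₁ =
    Θ₀∩Θ₁≡Δ (⟦ s ⟧ c) (⟦ t ⟧ c) (through s≡t₀) (through s≡t₁)
    where
    through : ∀ {a} → ⟦ s ⟧ a ≡ ⟦ t ⟧ a → Θ 𝔸 c a (⟦ s ⟧ c) (⟦ t ⟧ c)
    through eq =
      θ-trans (Θ-compatible s θ-base) (θ-trans (θ-eq eq) (θ-sym (Θ-compatible t θ-base)))

  π₀ π₁ : Carrier → Carrier → Carrier
  π₀ c s = q c 𝟎 s
  π₁ c s = q c s 𝟎

  -- π₀ c and π₁ c are the projections of A ≅ A/θ(c,0) × A/θ(c,1).
  record CentralIdentities (c : Carrier) : Set where
    field
      π₀-+   : ∀ s t → π₀ c (s + t) ≡ π₀ c (π₀ c s + π₀ c t)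
      π₀-′   : ∀ s → π₀ c (s ′) ≡ π₀ c (π₀ c s ′)
      π₀-gen : π₀ c c ≡ π₀ c 𝟎
      π₁-+   : ∀ s t → π₁ c (s + t) ≡ π₁ c (π₁ c s + π₁ c t)
      π₁-′   : ∀ s → π₁ c (s ′) ≡ π₁ c (π₁ c s ′)
      π₁-gen : π₁ c c ≡ π₁ c 𝟏
      q-π    : ∀ s → q c (π₁ c s) (π₀ c s) ≡ s
  open CentralIdentities

  𝟎-identities : CentralIdentities 𝟎
  π₀-+   𝟎-identities s t rewrite q-𝟎 𝟎 (s + t) | q-𝟎 𝟎 s | q-𝟎 𝟎 t | q-𝟎 𝟎 (s + t) = refl
  π₀-′   𝟎-identities s rewrite q-𝟎 𝟎 (s ′) | q-𝟎 𝟎 s | q-𝟎 𝟎 (s ′) = refl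
  π₀-gen 𝟎-identities = refl
  π₁-+   𝟎-identities s t rewrite q-𝟎 (s + t) 𝟎 | q-𝟎 s 𝟎 | q-𝟎 t 𝟎 | q-𝟎 (𝟎 + 𝟎) 𝟎 = refl
  π₁-′   𝟎-identities s rewrite q-𝟎 (s ′) 𝟎 | q-𝟎 s 𝟎 | q-𝟎 (𝟎 ′) 𝟎 = refl
  π₁-gen 𝟎-identities rewrite q-𝟎 𝟎 𝟎 | q-𝟎 𝟏 𝟎 = refl
  q-π    𝟎-identities s rewrite q-𝟎 s 𝟎 | q-𝟎 𝟎 s | q-𝟎 𝟎 s = refl

  𝟏-identities : CentralIdentities 𝟏
  π₀-+   𝟏-identities s t rewrite q-𝟏 𝟎 (s + t) | q-𝟏 𝟎 (π₀ 𝟏 s + π₀ 𝟏 t) = refl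
  π₀-′   𝟏-identities s rewrite q-𝟏 𝟎 (s ′) | q-𝟏 𝟎 (π₀ 𝟏 s ′) = refl
  π₀-gen 𝟏-identities = trans (q-𝟏 𝟎 𝟏) (sym (q-𝟏 𝟎 𝟎))
  π₁-+   𝟏-identities s t rewrite q-𝟏 (s + t) 𝟎 | q-𝟏 s 𝟎 | q-𝟏 t 𝟎 | q-𝟏 (s + t) 𝟎 = refl
  π₁-′   𝟏-identities s rewrite q-𝟏 (s ′) 𝟎 | q-𝟏 s 𝟎 | q-𝟏 (s ′) 𝟎 = refl
  π₁-gen 𝟏-identities = refl
  q-π    𝟏-identities s rewrite q-𝟏 s 𝟎 | q-𝟏 s (π₀ 𝟏 s) = refl

  identities-at-central : ∀ {c} → IsCentral 𝔸 c → ∀ h →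
    CentralIdentities (⟦ h ⟧ 𝟎) → CentralIdentities (⟦ h ⟧ 𝟏) → CentralIdentities (⟦ h ⟧ c)
  identities-at-central {c} cc h I₀ I₁ = record
    { π₀-+   = λ s t → agree (π₀ᴾ ⌜ s + t ⌝) (π₀ᴾ (π₀ᴾ ⌜ s ⌝ ⊕ π₀ᴾ ⌜ t ⌝))
                             (π₀-+ I₀ s t) (π₀-+ I₁ s t)
    ; π₀-′   = λ s → agree (π₀ᴾ ⌜ s ′ ⌝) (π₀ᴾ (π₀ᴾ ⌜ s ⌝ ᶜ)) (π₀-′ I₀ s) (π₀-′ I₁ s)
    ; π₀-gen = agree (π₀ᴾ h) (π₀ᴾ ⌜ 𝟎 ⌝) (π₀-gen I₀) (π₀-gen I₁)
    ; π₁-+   = λ s t → agree (π₁ᴾ ⌜ s + t ⌝) (π₁ᴾ (π₁ᴾ ⌜ s ⌝ ⊕ π₁ᴾ ⌜ t ⌝))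
                             (π₁-+ I₀ s t) (π₁-+ I₁ s t)
    ; π₁-′   = λ s → agree (π₁ᴾ ⌜ s ′ ⌝) (π₁ᴾ (π₁ᴾ ⌜ s ⌝ ᶜ)) (π₁-′ I₀ s) (π₁-′ I₁ s)
    ; π₁-gen = agree (π₁ᴾ h) (π₁ᴾ ⌜ 𝟏 ⌝) (π₁-gen I₀) (π₁-gen I₁)
    ; q-π    = λ s → agree (qᴾ h (π₁ᴾ ⌜ s ⌝) (π₀ᴾ ⌜ s ⌝)) ⌜ s ⌝ (q-π I₀ s) (q-π I₁ s)
    }
    where
    agree : ∀ s t → ⟦ s ⟧ 𝟎 ≡ ⟦ t ⟧ 𝟎 → ⟦ s ⟧ 𝟏 ≡ ⟦ t ⟧ 𝟏 → ⟦ s ⟧ c ≡ ⟦ t ⟧ c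
    agree = central-agree cc
    π₀ᴾ π₁ᴾ : Poly → Poly
    π₀ᴾ t = qᴾ h ⌜ 𝟎 ⌝ t
    π₁ᴾ t = qᴾ h t ⌜ 𝟎 ⌝

  Θ⊆kernel : (π : Carrier → Carrier) →
    (∀ s t → π (s + t) ≡ π (π s + π t)) → (∀ s → π (s ′) ≡ π (π s ′)) →
    ∀ {a b} → π a ≡ π b → ∀ {u v} → Θ 𝔸 a b u v → π u ≡ π v
  Θ⊆kernel π π-+ π-′ πa≡πb = go
    where
    go : ∀ {u v} → Θ 𝔸 _ _ u v → π u ≡ π v
    go θ-base          = πa≡πb
    go (θ-eq u≡v)      = cong π u≡v
    go θ-refl          = refl
    go (θ-sym r)       = sym (go r)
    go (θ-trans r s)   = trans (go r) (go s)
    go (θ-⊕ {x} {x′} {y} {y′} r s) = begin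
      π (x + y)         ≡⟨ π-+ x y ⟩
      π (π x + π y)     ≡⟨ cong₂ (λ a b → π (a + b)) (go r) (go s) ⟩
      π (π x′ + π y′)   ≡⟨ sym (π-+ x′ y′) ⟩
      π (x′ + y′)       ∎
    go (θ-neg {x} {y} r) = begin
      π (x ′)           ≡⟨ π-′ x ⟩
      π (π x ′)         ≡⟨ cong (λ a → π (a ′)) (go r) ⟩
      π (π y ′)         ≡⟨ sym (π-′ y) ⟩
      π (y ′)           ∎

  Θ-meet-trivial : ∀ {c} → CentralIdentities c → ∀ t → π₁ c c ≡ π₁ c t →
    ∀ u v → Θ 𝔸 c 𝟎 u v → Θ 𝔸 c t u v → u ≡ v
  Θ-meet-trivial {c} I t gen u v u≈₀v u≈ₜv = begin
    u                      ≡⟨ sym (q-π I u) ⟩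
    q c (π₁ c u) (π₀ c u)  ≡⟨ cong₂ (q c) π₁u≡π₁v π₀u≡π₀v ⟩
    q c (π₁ c v) (π₀ c v)  ≡⟨ q-π I v ⟩
    v                      ∎
    where
    π₀u≡π₀v : π₀ c u ≡ π₀ c v
    π₀u≡π₀v = Θ⊆kernel (π₀ c) (π₀-+ I) (π₀-′ I) (π₀-gen I) u≈₀v
    π₁u≡π₁v : π₁ c u ≡ π₁ c v
    π₁u≡π₁v = Θ⊆kernel (π₁ c) (π₁-+ I) (π₁-′ I) gen u≈ₜv

  Θ₀∘Θ₁-total : ∀ c u v → ∃ λ w → Θ 𝔸 c 𝟎 u w × Θ 𝔸 c 𝟏 w v
  Θ₀∘Θ₁-total c u v =
      q c v u
    , θ-sym (θ-trans (Θ-compatible (qᴾ var ⌜ v ⌝ ⌜ u ⌝) θ-base) (θ-eq (q-𝟎 v u)))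
    , θ-trans (Θ-compatible (qᴾ var ⌜ v ⌝ ⌜ u ⌝) θ-base) (θ-eq (q-𝟏 v u))

  identities⇒central : ∀ {c} → CentralIdentities c → IsCentral 𝔸 c
  identities⇒central {c} I = Θ-meet-trivial I 𝟏 (π₁-gen I) , Θ₀∘Θ₁-total c

  central⇒identities : ∀ {c} → IsCentral 𝔸 c → CentralIdentities c
  central⇒identities cc = identities-at-central cc var 𝟎-identities 𝟏-identities

  ′-central : ∀ {c} → IsCentral 𝔸 c → IsCentral 𝔸 (c ′)
  ′-central cc = identities⇒central
    (identities-at-central cc (var ᶜ) (subst CentralIdentities (sym ′-𝟎) 𝟏-identities) 𝟎-identities)

  ∧-central : ∀ {c x} → IsCentral 𝔸 c → IsCentral 𝔸 x → IsCentral 𝔸 (c ∧ x)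
  ∧-central {x = x} cc cx = identities⇒central (identities-at-central cc (var ∧ᴾ ⌜ x ⌝)
    (subst CentralIdentities (sym (∧-zeroˡ x)) 𝟎-identities)
    (subst CentralIdentities (sym (∧-identityˡ x)) (central⇒identities cx)))

  ∧-zeroʳ : ∀ {c} → IsCentral 𝔸 c → c ∧ 𝟎 ≡ 𝟎
  ∧-zeroʳ cc = central-agree cc (var ∧ᴾ ⌜ 𝟎 ⌝) ⌜ 𝟎 ⌝ (∧-zeroˡ 𝟎) (∧-identityˡ 𝟎)

  +-idem : ∀ {c} → IsCentral 𝔸 c → c + c ≡ c
  +-idem cc = central-agree cc (var ⊕ var) var (ax-b1 𝟎) (ax-b2 𝟏)

  module _ {c : Carrier} (cc : IsCentral 𝔸 c) where
    agree : ∀ s t → ⟦ s ⟧ 𝟎 ≡ ⟦ t ⟧ 𝟎 → ⟦ s ⟧ 𝟏 ≡ ⟦ t ⟧ 𝟏 → ⟦ s ⟧ c ≡ ⟦ t ⟧ c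
    agree = central-agree cc

    ∧-idem : c ∧ c ≡ c
    ∧-idem = agree (var ∧ᴾ var) var (∧-zeroˡ 𝟎) (∧-identityˡ 𝟏)

    ∧-absorbs-+ : ∀ y → c ∧ (c + y) ≡ c
    ∧-absorbs-+ y = agree (var ∧ᴾ (var ⊕ ⌜ y ⌝)) var
      (∧-zeroˡ _) (trans (∧-identityˡ _) (+-zeroˡ y))

    c∧x≼c : ∀ x → (c ∧ x) ≼ c
    c∧x≼c x = agree (var ∧ᴾ ⌜ x ⌝ ⊕ var) var
      (trans (cong (_+ 𝟎) (∧-zeroˡ x)) (ax-b1 𝟎)) (ax-b2 _)

    c∧x≼x : ∀ {x} → IsCentral 𝔸 x → (c ∧ x) ≼ x
    c∧x≼x {x} cx = agree (var ∧ᴾ ⌜ x ⌝ ⊕ ⌜ x ⌝) ⌜ x ⌝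
      (trans (cong (_+ x) (∧-zeroˡ x)) (ax-b1 x)) (trans (cong (_+ x) (∧-identityˡ x)) (+-idem cx))

    ∧-projection : ∀ b → c ∧ (c ∧ b) ≡ c ∧ b
    ∧-projection b = agree (var ∧ᴾ (var ∧ᴾ ⌜ b ⌝)) (var ∧ᴾ ⌜ b ⌝)
      (trans (∧-zeroˡ _) (sym (∧-zeroˡ b))) (∧-identityˡ _)

    ∧-distrib-+ : ∀ s t → c ∧ (s + t) ≡ c ∧ (c ∧ s + c ∧ t)
    ∧-distrib-+ s t = agree (var ∧ᴾ ⌜ s + t ⌝) (var ∧ᴾ (var ∧ᴾ ⌜ s ⌝ ⊕ var ∧ᴾ ⌜ t ⌝))
      (trans (∧-zeroˡ _) (sym (∧-zeroˡ _)))
      (cong (𝟏 ∧_) (sym (cong₂ _+_ (∧-identityˡ s) (∧-identityˡ t))))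

    ∧-distrib-′ : ∀ s → c ∧ (s ′) ≡ c ∧ ((c ∧ s) ′)
    ∧-distrib-′ s = agree (var ∧ᴾ ⌜ s ′ ⌝) (var ∧ᴾ (var ∧ᴾ ⌜ s ⌝) ᶜ)
      (trans (∧-zeroˡ _) (sym (∧-zeroˡ _))) (cong (λ w → 𝟏 ∧ (w ′)) (sym (∧-identityˡ s)))

    ∧-+-closed : ∀ a b → c ∧ (c ∧ a + c ∧ b) ≡ c ∧ a + c ∧ b
    ∧-+-closed a b = agree (var ∧ᴾ (var ∧ᴾ ⌜ a ⌝ ⊕ var ∧ᴾ ⌜ b ⌝)) (var ∧ᴾ ⌜ a ⌝ ⊕ var ∧ᴾ ⌜ b ⌝)
      (trans (∧-zeroˡ _) (sym (trans (cong₂ _+_ (∧-zeroˡ a) (∧-zeroˡ b)) (ax-b1 𝟎))))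
      (∧-identityˡ _)

    ∧-bottom : c ∧ ((c ∧ 𝟏) ′) ≡ 𝟎
    ∧-bottom = agree (var ∧ᴾ (var ∧ᴾ ⌜ 𝟏 ⌝) ᶜ) ⌜ 𝟎 ⌝
      (∧-zeroˡ _) (trans (∧-identityˡ _) (cong _′ (∧-identityˡ 𝟏)))

    ∧-q-top : ∀ b u → c ∧ q (c ∧ 𝟏) (c ∧ b) u ≡ c ∧ b
    ∧-q-top b u = agree (var ∧ᴾ qᴾ (var ∧ᴾ ⌜ 𝟏 ⌝) (var ∧ᴾ ⌜ b ⌝) ⌜ u ⌝) (var ∧ᴾ ⌜ b ⌝)
      (trans (∧-zeroˡ _) (sym (∧-zeroˡ b))) top
      where
      top : 𝟏 ∧ q (𝟏 ∧ 𝟏) (𝟏 ∧ b) u ≡ 𝟏 ∧ b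
      top rewrite ∧-identityˡ 𝟏 | ∧-identityˡ b | q-𝟏 b u = ∧-identityˡ b

    ∧-closed : ∀ {f} → IsCentral 𝔸 f → ∀ b → c ∧ (f ∧ (c ∧ b)) ≡ f ∧ (c ∧ b)
    ∧-closed {f} cf b = agree (var ∧ᴾ (⌜ f ⌝ ∧ᴾ (var ∧ᴾ ⌜ b ⌝))) (⌜ f ⌝ ∧ᴾ (var ∧ᴾ ⌜ b ⌝))
      (trans (∧-zeroˡ _) (sym (trans (cong (f ∧_) (∧-zeroˡ b)) (∧-zeroʳ cf)))) (∧-identityˡ _)

    ∧-disjoint : ∀ b → (c ′) ∧ (c ∧ b) ≡ 𝟎
    ∧-disjoint b = agree ((var ᶜ) ∧ᴾ (var ∧ᴾ ⌜ b ⌝)) ⌜ 𝟎 ⌝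
      (trans (cong (_∧ (𝟎 ∧ b)) ′-𝟎) (trans (∧-identityˡ _) (∧-zeroˡ b))) (∧-zeroˡ _)

    ∧-split : ∀ y → q c (c ∧ y) ((c ′) ∧ y) ≡ y
    ∧-split y = agree (qᴾ var (var ∧ᴾ ⌜ y ⌝) ((var ᶜ) ∧ᴾ ⌜ y ⌝)) ⌜ y ⌝
      (trans (q-𝟎 _ _) (trans (cong (_∧ y) ′-𝟎) (∧-identityˡ y))) (trans (q-𝟏 _ _) (∧-identityˡ y))

    q-𝟎-complement : ∀ x → q c 𝟎 ((c ′) ∧ x) ≡ (c ′) ∧ x
    q-𝟎-complement x = agree (qᴾ var ⌜ 𝟎 ⌝ ((var ᶜ) ∧ᴾ ⌜ x ⌝)) ((var ᶜ) ∧ᴾ ⌜ x ⌝)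
      (q-𝟎 _ _) (trans (q-𝟏 _ _) (sym (∧-zeroˡ x)))

    π₁-relative-top : ∀ {y} → IsCentral 𝔸 y → y ≡ c ∧ y → π₁ y y ≡ π₁ y (c ∧ 𝟏)
    π₁-relative-top {y} cy y≡c∧y =
      subst (λ w → π₁ w w ≡ π₁ w (c ∧ 𝟏)) (sym y≡c∧y) relative
      where
      at𝟎 : π₁ (𝟎 ∧ y) (𝟎 ∧ y) ≡ π₁ (𝟎 ∧ y) (𝟎 ∧ 𝟏)
      at𝟎 rewrite ∧-zeroˡ y | ∧-zeroˡ 𝟏 = refl
      at𝟏 : π₁ (𝟏 ∧ y) (𝟏 ∧ y) ≡ π₁ (𝟏 ∧ y) (𝟏 ∧ 𝟏)
      at𝟏 rewrite ∧-identityˡ y | ∧-identityˡ 𝟏 = π₁-gen (central⇒identities cy)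
      relative : π₁ (c ∧ y) (c ∧ y) ≡ π₁ (c ∧ y) (c ∧ 𝟏)
      relative = agree (qᴾ (var ∧ᴾ ⌜ y ⌝) (var ∧ᴾ ⌜ y ⌝) ⌜ 𝟎 ⌝)
                       (qᴾ (var ∧ᴾ ⌜ y ⌝) (var ∧ᴾ ⌜ 𝟏 ⌝) ⌜ 𝟎 ⌝) at𝟎 at𝟏

  complement-excludes : ∀ {e x} → IsCentral 𝔸 e → ¬ e ≡ 𝟎 → InA_ A (e ′) x → ¬ x ≡ e
  complement-excludes {e} ce e≢𝟎 (b , refl) x≡e = e≢𝟎 (begin
    e                    ≡⟨ sym (∧-idem ce) ⟩
    e ∧ e                ≡⟨ cong (e ∧_) (sym x≡e) ⟩
    e ∧ ((e ′) ∧ b)      ≡⟨ cong (λ w → w ∧ ((e ′) ∧ b)) (sym (ax-a e)) ⟩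
    (e ′ ′) ∧ ((e ′) ∧ b) ≡⟨ ∧-disjoint (′-central ce) b ⟩
    𝟎                    ∎)

  disjoint⇒complement-member : ∀ {e x} → IsCentral 𝔸 e → e ∧ x ≡ 𝟎 → x ≡ (e ′) ∧ x
  disjoint⇒complement-member {e} {x} ce e∧x≡𝟎 = begin
    x                          ≡⟨ sym (∧-split ce x) ⟩
    q e (e ∧ x) ((e ′) ∧ x)    ≡⟨ cong (λ w → q e w ((e ′) ∧ x)) e∧x≡𝟎 ⟩
    q e 𝟎 ((e ′) ∧ x)          ≡⟨ q-𝟎-complement ce x ⟩
    (e ′) ∧ x                  ∎

  distinct-atoms-disjoint : ∀ {e x} → IsAtom 𝔸 e → IsAtom 𝔸 x → ¬ x ≡ e → e ∧ x ≡ 𝟎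
  distinct-atoms-disjoint {e} {x} (ce , _ , e-min) (cx , _ , x-min) x≢e =
    pick (x-min (e ∧ x) c∧ (c∧x≼x ce cx)) (e-min (e ∧ x) c∧ (c∧x≼c ce x))
    where
    c∧ : IsCentral 𝔸 (e ∧ x)
    c∧ = ∧-central ce cx
    pick : (e ∧ x ≡ 𝟎) ⊎ (e ∧ x ≡ x) → (e ∧ x ≡ 𝟎) ⊎ (e ∧ x ≡ e) → e ∧ x ≡ 𝟎
    pick (inj₁ ≡𝟎) _          = ≡𝟎
    pick (inj₂ _) (inj₁ ≡𝟎)   = ≡𝟎
    pick (inj₂ ≡x) (inj₂ ≡e)  = ⊥-elim (x≢e (trans (sym ≡x) ≡e))

  module Relative {d : Carrier} (cd : IsCentral 𝔸 d) where
    R : Alg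
    R = relAlg A d

    open Alg R using () renaming (U to Uᴿ; _⊕_ to _⊕ᴿ_; neg to negᴿ; top to topᴿ; bot to botᴿ)

    qᴿ : Uᴿ → Uᴿ → Uᴿ → Uᴿ
    qᴿ X Y Z = negᴿ (negᴿ (X ⊕ᴿ Z) ⊕ᴿ negᴿ (negᴿ X ⊕ᴿ Y))

    restrict : Carrier → Uᴿ
    restrict y = d ∧ y , y , refl

    member-fixed : (Y : Uᴿ) → d ∧ proj₁ Y ≡ proj₁ Y
    member-fixed (_ , b , refl) = ∧-projection cd b

    member-+-closed : (X Y : Uᴿ) → d ∧ (proj₁ X + proj₁ Y) ≡ proj₁ X + proj₁ Y
    member-+-closed (_ , a , refl) (_ , b , refl) = ∧-+-closed cd a b

    below-member : ∀ {f} → IsCentral 𝔸 f → (X : Uᴿ) → f ≼ proj₁ X → f ≡ d ∧ f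
    below-member {f} cf (x , b , refl) f≼x = sym (begin
      d ∧ f              ≡⟨ cong (d ∧_) f≡f∧x ⟩
      d ∧ (f ∧ x)        ≡⟨ ∧-closed cd cf b ⟩
      f ∧ x              ≡⟨ sym f≡f∧x ⟩
      f                  ∎)
      where
      f≡f∧x : f ≡ f ∧ x
      f≡f∧x = trans (sym (∧-absorbs-+ cf x)) (cong (f ∧_) f≼x)

    qᴿ-forget : ∀ X Y Z → proj₁ (qᴿ X Y Z) ≡ d ∧ q (proj₁ X) (proj₁ Y) (proj₁ Z)
    qᴿ-forget (x , _) (y , _) (z , _) = central-agree cd
      (var ∧ᴾ (var ∧ᴾ (var ∧ᴾ (var ∧ᴾ (⌜ x ⌝ ⊕ ⌜ z ⌝)) ᶜ
                      ⊕ var ∧ᴾ (var ∧ᴾ (var ∧ᴾ ⌜ x ′ ⌝ ⊕ ⌜ y ⌝)) ᶜ)) ᶜ)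
      (var ∧ᴾ ⌜ q x y z ⌝)
      (trans (∧-zeroˡ _) (sym (∧-zeroˡ _))) at𝟏
      where
      at𝟏 : 𝟏 ∧ ((𝟏 ∧ (𝟏 ∧ ((𝟏 ∧ (x + z)) ′) + 𝟏 ∧ ((𝟏 ∧ (𝟏 ∧ (x ′) + y)) ′))) ′) ≡ 𝟏 ∧ q x y z
      at𝟏 rewrite ∧-identityˡ (x ′) | ∧-identityˡ (x ′ + y) | ∧-identityˡ ((x ′ + y) ′)
                | ∧-identityˡ (x + z) | ∧-identityˡ ((x + z) ′)
                | ∧-identityˡ ((x + z) ′ + (x ′ + y) ′) = refl

    qᴿ-bot : ∀ V U → proj₁ (qᴿ botᴿ V U) ≡ proj₁ U
    qᴿ-bot V U = begin
      proj₁ (qᴿ botᴿ V U)                            ≡⟨ qᴿ-forget botᴿ V U ⟩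
      d ∧ q (d ∧ ((d ∧ 𝟏) ′)) (proj₁ V) (proj₁ U)    ≡⟨ cong (λ w → d ∧ q w (proj₁ V) (proj₁ U)) (∧-bottom cd) ⟩
      d ∧ q 𝟎 (proj₁ V) (proj₁ U)                    ≡⟨ cong (d ∧_) (q-𝟎 _ _) ⟩
      d ∧ proj₁ U                                    ≡⟨ member-fixed U ⟩
      proj₁ U                                        ∎

    qᴿ-top : ∀ V U → proj₁ (qᴿ topᴿ V U) ≡ proj₁ V
    qᴿ-top V@(_ , b , refl) U = trans (qᴿ-forget topᴿ V U) (∧-q-top cd b (proj₁ U))

    Θ-forget : ∀ {a b u v} → Θ R a b u v → Θ 𝔸 (proj₁ a) (proj₁ b) (proj₁ u) (proj₁ v)
    Θ-forget θ-base        = θ-base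
    Θ-forget (θ-eq u≡v)    = θ-eq u≡v
    Θ-forget θ-refl        = θ-refl
    Θ-forget (θ-sym r)     = θ-sym (Θ-forget r)
    Θ-forget (θ-trans r s) = θ-trans (Θ-forget r) (Θ-forget s)
    Θ-forget (θ-⊕ r s)     = Θ-compatible (⌜ d ⌝ ∧ᴾ var) (θ-⊕ (Θ-forget r) (Θ-forget s))
    Θ-forget (θ-neg r)     = Θ-compatible (⌜ d ⌝ ∧ᴾ var) (θ-neg (Θ-forget r))

    Θ-restrict : ∀ {a b u v} → Θ 𝔸 a b u v → Θ R (restrict a) (restrict b) (restrict u) (restrict v)
    Θ-restrict θ-base        = θ-base
    Θ-restrict (θ-eq u≡v)    = θ-eq (cong (d ∧_) u≡v)
    Θ-restrict θ-refl        = θ-refl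
    Θ-restrict (θ-sym r)     = θ-sym (Θ-restrict r)
    Θ-restrict (θ-trans r s) = θ-trans (Θ-restrict r) (Θ-restrict s)
    Θ-restrict (θ-⊕ {x} {x′} {y} {y′} r s) =
      θ-trans (θ-eq (∧-distrib-+ cd x y))
        (θ-trans (θ-⊕ (Θ-restrict r) (Θ-restrict s)) (θ-eq (sym (∧-distrib-+ cd x′ y′))))
    Θ-restrict (θ-neg {x} {y} r) =
      θ-trans (θ-eq (∧-distrib-′ cd x)) (θ-trans (θ-neg (Θ-restrict r)) (θ-eq (sym (∧-distrib-′ cd y))))

    Θ-cong-generators : ∀ {a b a′ b′ u v} → Θ R a b u v →
      proj₁ a ≡ proj₁ a′ → proj₁ b ≡ proj₁ b′ → Θ R a′ b′ u v
    Θ-cong-generators θ-base a≈a′ b≈b′ = θ-trans (θ-eq a≈a′) (θ-trans θ-base (θ-eq (sym b≈b′)))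
    Θ-cong-generators (θ-eq u≡v)    _ _ = θ-eq u≡v
    Θ-cong-generators θ-refl        _ _ = θ-refl
    Θ-cong-generators (θ-sym r)     a≈a′ b≈b′ = θ-sym (Θ-cong-generators r a≈a′ b≈b′)
    Θ-cong-generators (θ-trans r s) a≈a′ b≈b′ =
      θ-trans (Θ-cong-generators r a≈a′ b≈b′) (Θ-cong-generators s a≈a′ b≈b′)
    Θ-cong-generators (θ-⊕ r s)     a≈a′ b≈b′ =
      θ-⊕ (Θ-cong-generators r a≈a′ b≈b′) (Θ-cong-generators s a≈a′ b≈b′)
    Θ-cong-generators (θ-neg r)     a≈a′ b≈b′ = θ-neg (Θ-cong-generators r a≈a′ b≈b′)

    Θᴿ₀∘Θᴿ₁-total : ∀ X U V → ∃ λ W → Θ R X botᴿ U W × Θ R X topᴿ W V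
    Θᴿ₀∘Θᴿ₁-total X U V =
        qᴿ X V U
      , θ-sym (θ-trans (qᴿ-cong θ-base) (θ-eq (qᴿ-bot V U)))
      , θ-trans (qᴿ-cong θ-base) (θ-eq (qᴿ-top V U))
      where
      qᴿ-cong : ∀ {a b X X′} → Θ R a b X X′ → Θ R a b (qᴿ X V U) (qᴿ X′ V U)
      qᴿ-cong r = θ-neg (θ-⊕ (θ-neg (θ-⊕ r (θ-refl {x = U}))) (θ-neg (θ-⊕ (θ-neg r) (θ-refl {x = V}))))

    central⇒relCentral : (Y : Uᴿ) → IsCentral 𝔸 (proj₁ Y) → IsCentral R Y
    central⇒relCentral Y cy = Θᴿ₀∩Θᴿ₁≡Δ , Θᴿ₀∘Θᴿ₁-total Y
      where
      Θᴿ₀∩Θᴿ₁≡Δ : ∀ U V → Θ R Y botᴿ U V → Θ R Y topᴿ U V → proj₁ U ≡ proj₁ V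
      Θᴿ₀∩Θᴿ₁≡Δ U V U≈₀V U≈₁V =
        Θ-meet-trivial (central⇒identities cy) (d ∧ 𝟏)
          (π₁-relative-top cd cy (sym (member-fixed Y))) (proj₁ U) (proj₁ V)
          (subst (λ w → Θ 𝔸 (proj₁ Y) w (proj₁ U) (proj₁ V)) (∧-bottom cd) (Θ-forget U≈₀V))
          (Θ-forget U≈₁V)

    -- u is recovered from d ∧ u, which the centrality of Y in A_d controls, and from d′ ∧ u,
    -- which θ(y,0) fixes because y lies below d.
    relCentral⇒central : (Y : Uᴿ) → IsCentral R Y → IsCentral 𝔸 (proj₁ Y)
    relCentral⇒central Y@(y , b , y≡d∧b) (Θᴿ₀∩Θᴿ₁≡Δ , _) = Θ₀∩Θ₁≡Δ , Θ₀∘Θ₁-total y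
      where
      Θ₀∩Θ₁≡Δ : ∀ u v → Θ 𝔸 y 𝟎 u v → Θ 𝔸 y 𝟏 u v → u ≡ v
      Θ₀∩Θ₁≡Δ u v u≈₀v u≈₁v = begin
        u                          ≡⟨ sym (∧-split cd u) ⟩
        q d (d ∧ u) ((d ′) ∧ u)    ≡⟨ cong₂ (q d) d∧u≡d∧v d′∧u≡d′∧v ⟩
        q d (d ∧ v) ((d ′) ∧ v)    ≡⟨ ∧-split cd v ⟩
        v                          ∎
        where
        d∧u≡d∧v : d ∧ u ≡ d ∧ v
        d∧u≡d∧v = Θᴿ₀∩Θᴿ₁≡Δ (restrict u) (restrict v)
          (Θ-cong-generators (Θ-restrict u≈₀v) (member-fixed Y) (trans (∧-zeroʳ cd) (sym (∧-bottom cd))))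
          (Θ-cong-generators (Θ-restrict u≈₁v) (member-fixed Y) refl)
        I : CentralIdentities (d ′)
        I = central⇒identities (′-central cd)
        d′∧u≡d′∧v : (d ′) ∧ u ≡ (d ′) ∧ v
        d′∧u≡d′∧v = Θ⊆kernel (π₁ (d ′)) (π₁-+ I) (π₁-′ I)
          (trans (cong ((d ′) ∧_) y≡d∧b) (trans (∧-disjoint cd b) (sym (∧-zeroʳ (′-central cd)))))
          u≈₀v

    relAtom⇒atom : (X : Uᴿ) → IsAtom R X → IsAtom 𝔸 (proj₁ X)
    relAtom⇒atom X@(x , _) (cX , X≢⊥ , X-min) =
      relCentral⇒central X cX , (λ x≡𝟎 → X≢⊥ (trans x≡𝟎 (sym (∧-bottom cd)))) , x-min
      where
      x-min : ∀ f → IsCentral 𝔸 f → f ≼ x → (f ≡ 𝟎) ⊎ (f ≡ x)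
      x-min f cf f≼x =
        Sum.map (λ f≡⊥ → trans f≡⊥ (∧-bottom cd)) id (X-min F (central⇒relCentral F cf) F⊕X≈X)
        where
        F : Uᴿ
        F = f , f , below-member cf X f≼x
        F⊕X≈X : d ∧ (f + x) ≡ x
        F⊕X≈X = trans (cong (d ∧_) f≼x) (member-fixed X)

    atom⇒relAtom : (X : Uᴿ) → IsAtom 𝔸 (proj₁ X) → IsAtom R X
    atom⇒relAtom X@(x , _) (cx , x≢𝟎 , x-min) =
      central⇒relCentral X cx , (λ x≡⊥ → x≢𝟎 (trans x≡⊥ (∧-bottom cd))) , X-min
      where
      X-min : ∀ F → IsCentral R F → proj₁ (F ⊕ᴿ X) ≡ x → (proj₁ F ≡ proj₁ botᴿ) ⊎ (proj₁ F ≡ x)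
      X-min F cF F⊕X≈X =
        Sum.map (λ f≡𝟎 → trans f≡𝟎 (sym (∧-bottom cd))) id
          (x-min (proj₁ F) (relCentral⇒central F cF) (trans (sym (member-+-closed F X)) F⊕X≈X))

lemma3p10 : (A : Orthogroupoid) → ZeroCommutative A →
    (e : Orthogroupoid.Carrier A) → IsAtom (asAlg A) e →
    (x : Orthogroupoid.Carrier A) →
      ((Σ (InA_ A (Orthogroupoid._′ A e) x) λ p → IsAtom (relAlg A (Orthogroupoid._′ A e)) (x , p))
        → (IsAtom (asAlg A) x × ¬ (x ≡ e)))
      × ((IsAtom (asAlg A) x × ¬ (x ≡ e))
        → Σ (InA_ A (Orthogroupoid._′ A e) x) λ p → IsAtom (relAlg A (Orthogroupoid._′ A e)) (x , p))
lemma3p10 A zc e e-atom@(ce , e≢𝟎 , _) x = relAtom⇒atom-≢e , atom-≢e⇒relAtom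
  where
  open Orthogroupoid A using (_′)
  open Properties A zc
  open Relative (′-central ce)

  relAtom⇒atom-≢e : (Σ (InA_ A (e ′) x) λ p → IsAtom R (x , p)) → IsAtom 𝔸 x × ¬ (x ≡ e)
  relAtom⇒atom-≢e (p , X-atom) = relAtom⇒atom (x , p) X-atom , complement-excludes ce e≢𝟎 p

  atom-≢e⇒relAtom : IsAtom 𝔸 x × ¬ (x ≡ e) → Σ (InA_ A (e ′) x) λ p → IsAtom R (x , p)
  atom-≢e⇒relAtom (x-atom , x≢e) = p , atom⇒relAtom (x , p) x-atom
    where
    p : InA_ A (e ′) x
    p = x , disjoint⇒complement-member ce (distinct-atoms-disjoint e-atom x-atom x≢e)
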